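{- Let $n,k>0$ be integers, let $P_n$ be the path on $n$ vertices, and let $m:=\lfloor n/(3k+2)\rfloor$. Then \[\beta_k(P_n)=\begin{cases}1, & \text{if } n=1;\\ 2m, & \text{if } n\bmod (3k+2)\in\{0,1\} \text{ (and } n\neq 1);\\ 2m+1, & \text{if } n \bmod (3k+2)\in\{2,\dots,k+2\};\\ 2m+2, & \text{if } n\bmod(3k+2)\in\{k+3,\dots,3k+1\}.\end{cases}\]
   Context: For a graph $G=(V,E)$ with geodesic (shortest-path) distance $d$, and an integer $k\ge 0$, define $d_k(u,v):=\min\{d(u,v),k+1\}$. A non-empty set $R\subseteq V$ is a $k$-truncated resolving set of $G$ if for all $u,v\in V$, $d_k(u,r)=d_k(v,r)$ for every $r\in R$ implies $u=v$. The $k$-truncated metric dimension $\beta_k(G)$ is the minimum size of a $k$-truncated resolving set of $G$. -}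

module Defs where

open import Data.Nat using (ℕ; zero; suc; _+_; _*_; _⊓_; _≤_; _<_; ∣_-_∣; NonZero)
open import Data.Nat.DivMod using (_/_; _%_)
open import Data.Fin using (Fin; toℕ)
open import Data.Fin.Subset using (Subset; _∈_; ∣_∣; Nonempty)
open import Data.Product using (_×_; Σ)
open import Relation.Binary.PropositionalEquality using (_≡_)

-- Geodesic distance in the path P_n on vertex set Fin n
-- (vertices 0,1,...,n-1, with i adjacent to i+1).
pathDist : {n : ℕ} → Fin n → Fin n → ℕ
pathDist i j = ∣ toℕ i - toℕ j ∣

truncDist : (k : ℕ) {n : ℕ} → Fin n → Fin n → ℕ
truncDist k u v = pathDist u v ⊓ suc k

IsTruncResolving : (k : ℕ) {n : ℕ} → Subset n → Set
IsTruncResolving k {n} R =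
  Nonempty R ×
  ((u v : Fin n) → ((r : Fin n) → r ∈ R → truncDist k u r ≡ truncDist k v r) → u ≡ v)

IsTruncMetricDimPath : (k n b : ℕ) → Set
IsTruncMetricDimPath k n b =
  Σ (Subset n) (λ R → IsTruncResolving k R × ∣ R ∣ ≡ b) ×
  ((R : Subset n) → IsTruncResolving k R → b ≤ ∣ R ∣)

{-# OPTIONS --safe #-}
module Submission where

-- A set of landmarks resolves P_n exactly when (i) at most one vertex is at
-- distance > k from every landmark, and (ii) no landmark r with 0 < r < n - 1
-- is at distance > k + 1 from all other landmarks (otherwise r - 1 and r + 1
-- have the same truncated distances; conversely two confused vertices are
-- either both uncovered or mirror images around such a landmark).
--
-- The b landmarks cut the path into b + 1 gaps. Call an inner gap long if it
-- has more than k vertices and an end gap long if it is non-empty. By (ii) no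
-- two consecutive gaps are long, so at most ⌊b/2⌋ + 1 of them are; a short
-- gap has at most k vertices (0 at an end), a long one at most 2k (k at an
-- end), plus the single uncovered vertex allowed by (i). Hence
-- n ≤ 1 + b(k + 1) + k⌊b/2⌋. Conversely, blocks of 3k + 2 vertices with
-- landmarks at offsets k and 2k + 1, followed by zero, one or two landmarks on
-- the remaining n mod (3k + 2) vertices, attain the least such b.

open import Defs
open import Data.Bool using (Bool; true; false; T; T?; _∨_; if_then_else_)
open import Data.Bool.Properties using (T-≡; T-∨)
open import Data.Empty using (⊥; ⊥-elim)
open import Data.Fin using (Fin; toℕ; fromℕ<) renaming (zero to fzero; suc to fsuc)
open import Data.Fin.Properties using (toℕ-fromℕ<; toℕ-injective; toℕ<n; any?)
open import Data.Fin.Subset using (Subset; _∈_; ∣_∣)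
open import Data.Nat
open import Data.Nat.DivMod using (_/_; _%_; m≡m%n+[m/n]*n)
open import Data.Nat.Properties
open import Algebra.Properties.CommutativeSemigroup +-commutativeSemigroup using (x∙yz≈y∙xz)
open import Data.Nat.Tactic.RingSolver using (solve-∀)
open import Data.Product using (_×_; _,_; proj₁; proj₂; ∃-syntax; ∃₂)
open import Data.Sum using (_⊎_; inj₁; inj₂)
open import Data.Unit using (⊤; tt)
open import Data.Vec using ([]; _∷_; lookup; tabulate)
open import Data.Vec.Properties using ([]=⇒lookup; lookup⇒[]=; lookup∘tabulate)
open import Function.Base using (_∘_)
open import Function.Bundles using (Equivalence)
open import Relation.Binary.Definitions using (tri<; tri≈; tri>)
open import Relation.Binary.PropositionalEquality
open import Relation.Nullary using (¬_; Dec; yes; no)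
open import Relation.Nullary.Decidable using (_×-dec_; map′)

Apart : ℕ → ℕ → ℕ → Set
Apart d x y = d + x ≤ y ⊎ d + y ≤ x

apart⇒≤∣-∣ : ∀ {d} x y → Apart d x y → d ≤ ∣ x - y ∣
apart⇒≤∣-∣ {d} x y (inj₁ d+x≤y) = begin
  d         ≤⟨ m+n≤o⇒m≤o∸n d d+x≤y ⟩
  y ∸ x     ≤⟨ m∸n≤∣m-n∣ y x ⟩
  ∣ y - x ∣ ≡⟨ ∣-∣-comm y x ⟩
  ∣ x - y ∣ ∎
  where open ≤-Reasoning
apart⇒≤∣-∣ {d} x y (inj₂ d+y≤x) = ≤-trans (m+n≤o⇒m≤o∸n d d+y≤x) (m∸n≤∣m-n∣ x y)

≤∣-∣⇒apart : ∀ {d} x y → d ≤ ∣ x - y ∣ → Apart d x y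
≤∣-∣⇒apart {d} x y d≤∣x-y∣ with ≤-total x y
... | inj₁ x≤y = inj₁ (m≤o∸n⇒m+n≤o d x≤y (subst (d ≤_) (m≤n⇒∣m-n∣≡n∸m x≤y) d≤∣x-y∣))
... | inj₂ y≤x = inj₂ (m≤o∸n⇒m+n≤o d y≤x (subst (d ≤_) (m≤n⇒∣n-m∣≡n∸m y≤x) d≤∣x-y∣))

d+[m+x]≤m+y⇒d+x≤y : ∀ d m {x y} → d + (m + x) ≤ m + y → d + x ≤ y
d+[m+x]≤m+y⇒d+x≤y d m {x} {y} le = +-cancelˡ-≤ m (d + x) y (subst (_≤ m + y) (x∙yz≈y∙xz d m x) le)

apart-cancelˡ : ∀ {d} m {x y} → Apart d (m + x) (m + y) → Apart d x y
apart-cancelˡ {d} m (inj₁ le) = inj₁ (d+[m+x]≤m+y⇒d+x≤y d m le)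
apart-cancelˡ {d} m (inj₂ le) = inj₂ (d+[m+x]≤m+y⇒d+x≤y d m le)

∣-∣-view : ∀ x y → (∃[ d ] y ≡ x + d × ∣ x - y ∣ ≡ d) ⊎ (∃[ d ] x ≡ y + d × ∣ x - y ∣ ≡ d)
∣-∣-view zero    y       = inj₁ (y , refl , refl)
∣-∣-view (suc x) zero    = inj₂ (suc x , refl , refl)
∣-∣-view (suc x) (suc y) with ∣-∣-view x y
... | inj₁ (d , y≡x+d , ∣x-y∣≡d) = inj₁ (d , cong suc y≡x+d , ∣x-y∣≡d)
... | inj₂ (d , x≡y+d , ∣x-y∣≡d) = inj₂ (d , cong suc x≡y+d , ∣x-y∣≡d)

equidistant⇒midpoint : ∀ {u v s} → u < v → ∣ u - s ∣ ≡ ∣ v - s ∣ → ∃[ d ] s ≡ u + d × v ≡ s + d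
equidistant⇒midpoint {u} {v} {s} u<v eq with ∣-∣-view u s | ∣-∣-view v s
... | inj₁ (d , refl , ∣u-s∣≡d) | inj₂ (e , refl , ∣v-s∣≡e) =
  d , refl , cong (s +_) (trans (sym ∣v-s∣≡e) (trans (sym eq) ∣u-s∣≡d))
... | inj₁ (d , refl , ∣u-s∣≡d) | inj₁ (e , s≡v+e , ∣v-s∣≡e) =
  ⊥-elim (<⇒≢ u<v (+-cancelʳ-≡ d u v (trans s≡v+e (cong (v +_) e≡d))))
  where
  e≡d : e ≡ d
  e≡d = trans (sym ∣v-s∣≡e) (trans (sym eq) ∣u-s∣≡d)
... | inj₂ (d , refl , ∣u-s∣≡d) | inj₂ (e , refl , ∣v-s∣≡e) =
  ⊥-elim (<⇒≢ u<v (cong (s +_) (trans (sym ∣u-s∣≡d) (trans eq ∣v-s∣≡e))))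
... | inj₂ (d , refl , _) | inj₁ (e , refl , _) =
  ⊥-elim (<⇒≱ u<v (≤-trans (m≤m+n v e) (m≤m+n (v + e) d)))

m+m≡n+n⇒m≡n : ∀ {m n} → m + m ≡ n + n → m ≡ n
m+m≡n+n⇒m≡n {m} {n} eq = trans (n≡⌊n+n/2⌋ m) (trans (cong ⌊_/2⌋ eq) (sym (n≡⌊n+n/2⌋ n)))

m⊓o≡n⊓o⇒m≡n⊎o≤m×o≤n : ∀ m n o → m ⊓ o ≡ n ⊓ o → m ≡ n ⊎ (o ≤ m × o ≤ n)
m⊓o≡n⊓o⇒m≡n⊎o≤m×o≤n m n o eq with ≤-total m o | ≤-total n o
... | inj₁ m≤o | inj₁ n≤o = inj₁ (trans (sym (m≤n⇒m⊓n≡m m≤o)) (trans eq (m≤n⇒m⊓n≡m n≤o)))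
... | inj₁ m≤o | inj₂ o≤n =
  inj₂ (≤-reflexive (trans (sym (m≥n⇒m⊓n≡n o≤n)) (trans (sym eq) (m≤n⇒m⊓n≡m m≤o))) , o≤n)
... | inj₂ o≤m | inj₁ n≤o =
  inj₂ (o≤m , ≤-reflexive (trans (sym (m≥n⇒m⊓n≡n o≤m)) (trans eq (m≤n⇒m⊓n≡m n≤o))))
... | inj₂ o≤m | inj₂ o≤n = inj₂ (o≤m , o≤n)

count : (ℕ → Bool) → ℕ → ℕ → ℕ
count f s zero    = zero
count f s (suc d) = if f s then suc (count f (suc s) d) else count f (suc s) d

count-++ : ∀ f s a d → count f s (a + d) ≡ count f s a + count f (s + a) d
count-++ f s zero    d = cong (λ t → count f t d) (sym (+-identityʳ s))
count-++ f s (suc a) d rewrite +-suc s a with f s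
... | true  = cong suc (count-++ f (suc s) a d)
... | false = count-++ f (suc s) a d

count-cong : ∀ {f g} s t d → (∀ i → i < d → f (s + i) ≡ g (t + i)) → count f s d ≡ count g t d
count-cong         s t zero    _  = refl
count-cong {f} {g} s t (suc d) eq =
  cong₂ (λ b c → if b then suc c else c) head (count-cong (suc s) (suc t) d tail)
  where
  head : f s ≡ g t
  head = trans (cong f (sym (+-identityʳ s))) (trans (eq 0 z<s) (cong g (+-identityʳ t)))
  tail : ∀ i → i < d → f (suc s + i) ≡ g (suc t + i)
  tail i i<d = trans (cong f (sym (+-suc s i))) (trans (eq (suc i) (s<s i<d)) (cong g (+-suc t i)))

count-none : ∀ f s d → (∀ i → i < d → ¬ T (f (s + i))) → count f s d ≡ 0
count-none f s zero    _    = refl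
count-none f s (suc d) none with f s in fs
... | true  = ⊥-elim (none 0 z<s (subst (T ∘ f) (sym (+-identityʳ s)) (Equivalence.from T-≡ fs)))
... | false = count-none f (suc s) d λ i i<d → none (suc i) (s<s i<d) ∘ subst (T ∘ f) (sym (+-suc s i))

count≡0⇒none : ∀ f s d → count f s d ≡ 0 → ∀ i → i < d → ¬ T (f (s + i))
count≡0⇒none f s (suc d) c≡0 i i<d fsi with f s in fs
count≡0⇒none f s (suc d) () i i<d fsi | true
count≡0⇒none f s (suc d) c≡0 zero    _         fsi | false =
  subst T (trans (cong f (+-identityʳ s)) fs) fsi
count≡0⇒none f s (suc d) c≡0 (suc i) (s<s i<d) fsi | false =
  count≡0⇒none f (suc s) d c≡0 i i<d (subst (T ∘ f) (+-suc s i) fsi)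

count≡suc⇒first : ∀ f s d {c} → count f s d ≡ suc c →
  ∃₂ λ g d′ → d ≡ suc (g + d′) × T (f (s + g)) × (∀ i → i < g → ¬ T (f (s + i))) ×
              count f (suc (s + g)) d′ ≡ c
count≡suc⇒first f s (suc d) {c} c≡ with f s in fs
... | true  = 0 , d , refl , subst (T ∘ f) (sym (+-identityʳ s)) (Equivalence.from T-≡ fs) , (λ _ ()) ,
              trans (cong (λ t → count f (suc t) d) (+-identityʳ s)) (suc-injective c≡)
... | false with count≡suc⇒first f (suc s) d c≡
...   | g , d′ , refl , fg , none , c′≡ =
  suc g , d′ , refl , subst (T ∘ f) (sym (+-suc s g)) fg , none′ ,
  subst (λ t → count f (suc t) d′ ≡ c) (sym (+-suc s g)) c′≡
  where
  none′ : ∀ i → i < suc g → ¬ T (f (s + i))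
  none′ zero    _         fsi = subst T (trans (cong f (+-identityʳ s)) fs) fsi
  none′ (suc i) (s<s i<g) fsi = none i i<g (subst (T ∘ f) (+-suc s i) fsi)

count-single : ∀ a s d → s ≤ a → a < s + d → count (_≡ᵇ a) s d ≡ 1
count-single a s zero    s≤a a<s+0 = ⊥-elim (<⇒≱ a<s+0 (subst (_≤ a) (sym (+-identityʳ s)) s≤a))
count-single a s (suc d) s≤a a<s+d with s ≡ᵇ a in s≡ᵇa
... | true  = cong suc (count-none (_≡ᵇ a) (suc s) d λ i _ i≡ᵇa →
                <⇒≢ (s≤s (m≤m+n s i)) (trans s≡a (sym (≡ᵇ⇒≡ _ a i≡ᵇa))))
  where
  s≡a : s ≡ a
  s≡a = ≡ᵇ⇒≡ s a (Equivalence.from T-≡ s≡ᵇa)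
... | false = count-single a (suc s) d (≤∧≢⇒< s≤a s≢a) (≤-trans a<s+d (≤-reflexive (+-suc s d)))
  where
  s≢a : s ≢ a
  s≢a s≡a = subst T s≡ᵇa (≡⇒≡ᵇ s a s≡a)

count-∨ : ∀ f g s d → (∀ i → T (f i) → T (g i) → ⊥) →
          count (λ i → f i ∨ g i) s d ≡ count f s d + count g s d
count-∨ f g s zero    disjoint = refl
count-∨ f g s (suc d) disjoint with f s in fs | g s in gs
... | true  | true  = ⊥-elim (disjoint s (Equivalence.from T-≡ fs) (Equivalence.from T-≡ gs))
... | true  | false = cong suc (count-∨ f g (suc s) d disjoint)
... | false | true  = trans (cong suc (count-∨ f g (suc s) d disjoint)) (sym (+-suc _ _))
... | false | false = count-∨ f g (suc s) d disjoint

-- The vertices of P_n are the naturals below n; f marks the landmarks, and its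
-- values from n on are ignored.
module Path (k n : ℕ) (f : ℕ → Bool) where

  IsLandmark : ℕ → Set
  IsLandmark r = r < n × T (f r)

  tdist : ℕ → ℕ → ℕ
  tdist x y = ∣ x - y ∣ ⊓ suc k

  SameSignature : ℕ → ℕ → Set
  SameSignature u v = ∀ r → IsLandmark r → tdist u r ≡ tdist v r

  Resolving : Set
  Resolving = ∀ u v → u < n → v < n → SameSignature u v → u ≡ v

  Uncovered : ℕ → Set
  Uncovered u = u < n × ∀ r → IsLandmark r → Apart (suc k) u r

  FarLeft : ℕ → Set
  FarLeft r = ∀ t → IsLandmark t → t < r → suc (suc k) + t ≤ r

  FarRight : ℕ → Set
  FarRight r = ∀ t → IsLandmark t → r < t → suc (suc k) + r ≤ t

  Isolated : ℕ → Set
  Isolated r = IsLandmark r × 0 < r × suc r < n × FarLeft r × FarRight r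

  AtMostOneUncovered : Set
  AtMostOneUncovered = ∀ u v → Uncovered u → Uncovered v → u ≡ v

  NoIsolated : Set
  NoIsolated = ∀ r → ¬ Isolated r

  Admissible : Set
  Admissible = AtMostOneUncovered × NoIsolated

  apart⇒tdist≡ : ∀ {x y} → Apart (suc k) x y → tdist x y ≡ suc k
  apart⇒tdist≡ {x} {y} apart = m≥n⇒m⊓n≡n (apart⇒≤∣-∣ x y apart)

  resolving⇒atMostOneUncovered : Resolving → AtMostOneUncovered
  resolving⇒atMostOneUncovered res u v (u<n , u-far) (v<n , v-far) = res u v u<n v<n λ r lr →
    trans (apart⇒tdist≡ (u-far r lr)) (sym (apart⇒tdist≡ (v-far r lr)))

  resolving⇒noIsolated : Resolving → NoIsolated
  resolving⇒noIsolated res (suc r) (_ , _ , r+2<n , farL , farR) =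
    <⇒≢ r<r+2 (res r (suc (suc r)) (<-trans r<r+2 r+2<n) r+2<n neighbours)
    where
    r<r+2 : r < suc (suc r)
    r<r+2 = m<n⇒m<1+n (n<1+n r)
    neighbours : SameSignature r (suc (suc r))
    neighbours t lt with <-cmp t (suc r)
    ... | tri< t<r _ _ =
      trans (apart⇒tdist≡ (inj₂ t≪r)) (sym (apart⇒tdist≡ (inj₂ (m≤n⇒m≤1+n (m≤n⇒m≤1+n t≪r)))))
      where
      t≪r : suc k + t ≤ r
      t≪r = ≤-pred (farL t lt t<r)
    ... | tri≈ _ refl _ = cong (_⊓ suc k) (∣-∣-comm r (suc r))
    ... | tri> _ _ r<t =
      trans (apart⇒tdist≡ (inj₁ (≤-trans (+-monoʳ-≤ (suc k) (n≤1+n r)) (<⇒≤ r≪t))))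
            (sym (apart⇒tdist≡ (inj₁ (subst (_≤ t) (sym (+-suc (suc k) (suc r))) r≪t))))
      where
      r≪t : suc (suc k) + suc r ≤ t
      r≪t = farR t lt r<t

  Near : ℕ → ℕ → Set
  Near x r = IsLandmark r × ∣ x - r ∣ ≤ k

  near? : ∀ x → Dec (∃[ r ] Near x r)
  near? x = map′ fromFin toFin (any? λ r → T? (f (toℕ r)) ×-dec (∣ x - toℕ r ∣ ≤? k))
    where
    fromFin : ∃[ r ] (T (f (toℕ r)) × ∣ x - toℕ r ∣ ≤ k) → ∃[ r ] Near x r
    fromFin (r , fr , near) = toℕ r , (toℕ<n r , fr) , near
    toFin : ∃[ r ] Near x r → ∃[ r ] (T (f (toℕ r)) × ∣ x - toℕ r ∣ ≤ k)
    toFin (r , (r<n , fr) , near) =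
      fromℕ< r<n , subst (λ t → T (f t) × ∣ x - t ∣ ≤ k) (sym (toℕ-fromℕ< r<n)) (fr , near)

  not-near⇒uncovered : ∀ {x} → x < n → ¬ (∃[ r ] Near x r) → Uncovered x
  not-near⇒uncovered {x} x<n far = x<n , λ r lr → ≤∣-∣⇒apart x r (≰⇒> λ near → far (r , lr , near))

  near⇒equidistant : ∀ {u v r} → SameSignature u v → Near u r → ∣ u - r ∣ ≡ ∣ v - r ∣
  near⇒equidistant {u} {v} {r} sig (lr , near) with m⊓o≡n⊓o⇒m≡n⊎o≤m×o≤n _ _ _ (sig r lr)
  ... | inj₁ eq             = eq
  ... | inj₂ (k<∣u-r∣ , _) = ⊥-elim (<⇒≱ k<∣u-r∣ near)

  midpoint-isolated : ∀ u d → 0 < d → d ≤ k → u + d + d < n → IsLandmark (u + d) →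
                      SameSignature u (u + d + d) → Isolated (u + d)
  midpoint-isolated u d 0<d d≤k v<n lr sig =
    lr , ≤-trans 0<d (m≤n+m d u) , ≤-<-trans x<x+d v<n , farL , farR
    where
    x<x+d : ∀ {x} → x < x + d
    x<x+d {x} = ≤-trans (≤-reflexive (+-comm 1 x)) (+-monoʳ-≤ x 0<d)
    apart-both : ∀ t → IsLandmark t → t ≢ u + d → Apart (suc k) u t × Apart (suc k) (u + d + d) t
    apart-both t lt t≢r with m⊓o≡n⊓o⇒m≡n⊎o≤m×o≤n _ _ _ (sig t lt)
    ... | inj₂ (k<∣u-t∣ , k<∣v-t∣) = ≤∣-∣⇒apart u t k<∣u-t∣ , ≤∣-∣⇒apart _ t k<∣v-t∣
    ... | inj₁ eq with equidistant⇒midpoint (≤-trans x<x+d (m≤m+n (u + d) d)) eq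
    ...   | e , refl , v≡ = ⊥-elim (t≢r (cong (u +_) (m+m≡n+n⇒m≡n (+-cancelˡ-≡ u (e + e) (d + d)
            (trans (sym (+-assoc u e e)) (trans (sym v≡) (+-assoc u d d)))))))
    farL : FarLeft (u + d)
    farL t lt t<r with proj₁ (apart-both t lt (<⇒≢ t<r))
    ... | inj₁ u≪t = ⊥-elim (<⇒≱ t<r (begin
      u + d     ≤⟨ +-monoʳ-≤ u d≤k ⟩
      u + k     ≡⟨ +-comm u k ⟩
      k + u     ≤⟨ n≤1+n (k + u) ⟩
      suc k + u ≤⟨ u≪t ⟩
      t         ∎))
      where open ≤-Reasoning
    ... | inj₂ t≪u = ≤-trans (s≤s t≪u) x<x+d
    farR : FarRight (u + d)
    farR t lt r<t with proj₂ (apart-both t lt (≢-sym (<⇒≢ r<t)))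
    ... | inj₁ v≪t = subst (_≤ t) (+-suc (suc k) (u + d)) (≤-trans (+-monoʳ-≤ (suc k) x<x+d) v≪t)
    ... | inj₂ t≪v = ⊥-elim (<⇒≱ (m≤n⇒m≤1+n (s≤s d≤k)) (+-cancelˡ-≤ (u + d) _ _ (begin
      u + d + suc (suc k)   ≡⟨ regroup u d k ⟩
      suc k + suc (u + d)   ≤⟨ +-monoʳ-≤ (suc k) r<t ⟩
      suc k + t             ≤⟨ t≪v ⟩
      u + d + d             ∎)))
      where
      open ≤-Reasoning
      regroup : ∀ u d k → u + d + suc (suc k) ≡ suc k + suc (u + d)
      regroup = solve-∀

  admissible-separates : Admissible → ∀ {u v} → u < v → v < n → ¬ SameSignature u v
  admissible-separates (one , noIso) {u} {v} u<v v<n sig with near? u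
  ... | yes (r , near) with equidistant⇒midpoint {s = r} u<v (near⇒equidistant {u} {v} sig near)
  ...   | d , refl , refl = noIso (u + d) (midpoint-isolated u d 0<d d≤k v<n (proj₁ near) sig)
    where
    0<d : 0 < d
    0<d = n≢0⇒n>0 λ { refl → <-irrefl (sym (trans (+-identityʳ (u + 0)) (+-identityʳ u))) u<v }
    d≤k : d ≤ k
    d≤k = subst (_≤ k) (∣m-m+n∣≡n u d) (proj₂ near)
  admissible-separates (one , noIso) {u} {v} u<v v<n sig | no far-u with near? v
  ... | yes (r , lr , near) =
    far-u (r , lr , subst (_≤ k) (near⇒equidistant {v} {u} (λ t lt → sym (sig t lt)) (lr , near)) near)
  ... | no far-v =
    <⇒≢ u<v (one u v (not-near⇒uncovered (<-trans u<v v<n) far-u) (not-near⇒uncovered v<n far-v))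

  admissible⇒resolving : Admissible → Resolving
  admissible⇒resolving adm u v u<n v<n sig with <-cmp u v
  ... | tri< u<v _ _ = ⊥-elim (admissible-separates adm u<v v<n sig)
  ... | tri≈ _ u≡v _ = u≡v
  ... | tri> _ _ v<u = ⊥-elim (admissible-separates adm v<u u<n λ r lr → sym (sig r lr))

  pair-covers : ∀ {p u} → IsLandmark k → IsLandmark p → p ≤ suc (k + k) → u ≤ p + k →
                ¬ Uncovered u
  pair-covers {p} {u} lk lp p≤2k+1 u≤p+k (_ , far) with u ≤? k + k | far k lk | far p lp
  ... | yes _    | inj₁ u≪k | _        = <⇒≱ (s≤s (m≤m+n k u)) u≪k
  ... | yes u≤2k | inj₂ k≪u | _        = <⇒≱ k≪u u≤2k
  ... | no u≰2k  | _        | inj₁ u≪p = <⇒≱ (s≤s (m≤n+m u k)) (≤-trans u≪p (≤-trans p≤2k+1 (≰⇒> u≰2k)))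
  ... | no _     | _        | inj₂ p≪u = <-irrefl refl (≤-trans p≪u (subst (u ≤_) (+-comm p k) u≤p+k))

  pair-not-isolated : ∀ {p} → IsLandmark k → IsLandmark p → k < p → p ≤ suc (k + k) →
                      ¬ Isolated k × ¬ Isolated p
  pair-not-isolated {p} lk lp k<p p≤2k+1 =
    (λ (_ , _ , _ , _ , farR) → too-close (farR p lp k<p)) ,
    (λ (_ , _ , _ , farL , _) → too-close (farL k lk k<p))
    where
    too-close : suc (suc k) + k ≤ p → ⊥
    too-close k≪p = <-irrefl refl (≤-trans k≪p p≤2k+1)

  Gap : ℕ → ℕ → Set
  Gap s t = ∀ r → IsLandmark r → r ≤ s ⊎ t ≤ r

  gap-after-last : ∀ {s t} → Gap s n → Gap s t
  gap-after-last gap r lr with gap r lr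
  ... | inj₁ r≤s = inj₁ r≤s
  ... | inj₂ n≤r = ⊥-elim (<⇒≱ (proj₁ lr) n≤r)

  window-gap : ∀ s g → (∀ i → i < g → ¬ T (f (suc s + i))) → Gap s (suc s + g)
  window-gap s g none r lr with r ≤? s
  ... | yes r≤s = inj₁ r≤s
  ... | no r≰s with m≤n⇒∃[o]m+o≡n (≰⇒> r≰s)
  ...   | i , refl with i <? g
  ...     | yes i<g = ⊥-elim (none i i<g (proj₂ lr))
  ...     | no i≮g  = inj₂ (+-monoʳ-≤ (suc s) (≮⇒≥ i≮g))

  uncovered-in-gap : ∀ {s t u} → Gap s t → t ≤ n + k → suc k + s ≤ u → suc k + u ≤ t →
                     Uncovered u
  uncovered-in-gap {s} {t} {u} gap t≤n+k s≪u u≪t = u<n , far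
    where
    u<n : u < n
    u<n = +-cancelʳ-≤ k (suc u) n (subst (_≤ n + k) (cong suc (+-comm k u)) (≤-trans u≪t t≤n+k))
    far : ∀ r → IsLandmark r → Apart (suc k) u r
    far r lr with gap r lr
    ... | inj₁ r≤s = inj₂ (≤-trans (+-monoʳ-≤ (suc k) r≤s) s≪u)
    ... | inj₂ t≤r = inj₁ (≤-trans u≪t t≤r)

  gap⇒farRight : ∀ {s t} → Gap s t → suc (suc k) + s ≤ t → FarRight s
  gap⇒farRight gap s≪t r lr s<r with gap r lr
  ... | inj₁ r≤s = ⊥-elim (<⇒≱ s<r r≤s)
  ... | inj₂ t≤r = ≤-trans s≪t t≤r

  gap⇒farLeft : ∀ {s t} → Gap s t → suc (suc k) + s ≤ t → FarLeft t
  gap⇒farLeft gap s≪t r lr r<t with gap r lr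
  ... | inj₁ r≤s = ≤-trans (+-monoʳ-≤ (suc (suc k)) r≤s) s≪t
  ... | inj₂ t≤r = ⊥-elim (<⇒≱ r<t t≤r)

  Lonely : Bool → ℕ → Set
  Lonely true  s = 0 < s × FarLeft s
  Lonely false s = ⊤

  Allowance : ℕ → ℕ → Set
  Allowance e s = ∀ u → Uncovered u → s ≤ u → 0 < e

  allowance-1 : ∀ {s} → Allowance 1 s
  allowance-1 _ _ _ = z<s

  allowance-later : ∀ {e s t} → Allowance e s → s ≤ t → Allowance e t
  allowance-later allow s≤t u unc t≤u = allow u unc (≤-trans s≤t t≤u)

bound : ℕ → ℕ → ℕ
bound k b = suc (b * suc k + k * ⌊ b /2⌋)

bound-mono : ∀ k {b c} → b ≤ c → bound k b ≤ bound k c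
bound-mono k b≤c = s≤s (+-mono-≤ (*-monoˡ-≤ (suc k) b≤c) (*-monoʳ-≤ k (⌊n/2⌋-mono b≤c)))

bound<⇒< : ∀ {k n b c} → bound k b < n → n ≤ bound k c → b < c
bound<⇒< {k} bound<n n≤bound = ≰⇒> λ c≤b → <⇒≱ bound<n (≤-trans n≤bound (bound-mono k c≤b))

period : ℕ → ℕ
period k = suc (suc (3 * k))

⌊2*n/2⌋≡n : ∀ n → ⌊ 2 * n /2⌋ ≡ n
⌊2*n/2⌋≡n n = trans (cong (λ x → ⌊ n + x /2⌋) (+-identityʳ n)) (sym (n≡⌊n+n/2⌋ n))

⌊1+2*n/2⌋≡n : ∀ n → ⌊ suc (2 * n) /2⌋ ≡ n
⌊1+2*n/2⌋≡n zero    = refl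
⌊1+2*n/2⌋≡n (suc n) = cong suc (trans (cong ⌊_/2⌋ (+-suc n (n + 0))) (⌊1+2*n/2⌋≡n n))

bound-even : ∀ k m → bound k (2 * m) ≡ suc (m * period k)
bound-even k m = cong suc (trans (cong (λ h → 2 * m * suc k + k * h) (⌊2*n/2⌋≡n m)) (regroup k m))
  where
  regroup : ∀ k m → 2 * m * suc k + k * m ≡ m * suc (suc (3 * k))
  regroup = solve-∀

bound-odd : ∀ k m → bound k (suc (2 * m)) ≡ m * period k + suc (suc k)
bound-odd k m = trans (cong (λ h → suc (suc (2 * m) * suc k + k * h)) (⌊1+2*n/2⌋≡n m)) (regroup k m)
  where
  regroup : ∀ k m → suc (suc (2 * m) * suc k + k * m) ≡ m * suc (suc (3 * k)) + suc (suc k)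
  regroup = solve-∀

bound-even< : ∀ k m {r} → 1 < r → bound k (2 * m) < m * period k + r
bound-even< k m {r} 1<r = subst (_< m * period k + r) (trans (+-comm (m * period k) 1) (sym (bound-even k m)))
  (+-monoʳ-< (m * period k) 1<r)

bound-odd< : ∀ k m {r} → suc (suc k) < r → bound k (suc (2 * m)) < m * period k + r
bound-odd< k m {r} k+2<r = subst (_< m * period k + r) (sym (bound-odd k m)) (+-monoʳ-< (m * period k) k+2<r)

-- An upper bound for the number of vertices after a landmark s that is
-- followed by c more landmarks: every landmark adds k + 1 and every long gap k,
-- and at most e further vertices may be uncovered. Among the c + 1 gaps after
-- s at most ⌈(c + 1)/2⌉ are long, and only ⌈c/2⌉ if s is lonely, that is,
-- if the gap before s is long.
room : ℕ → Bool → ℕ → ℕ → ℕ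
room k true  c e = c * suc k + k * ⌊ suc c /2⌋ + e
room k false c e = c * suc k + k * ⌊ suc (suc c) /2⌋ + e

room-lonely≤room : ∀ k lonely c e → room k true c e ≤ room k lonely c e
room-lonely≤room k true  c e = ≤-refl
room-lonely≤room k false c e =
  +-monoˡ-≤ e (+-monoʳ-≤ (c * suc k) (*-monoʳ-≤ k (⌊n/2⌋-mono (n≤1+n (suc c)))))

room-short : ∀ k lonely {g} c e → g ≤ k → suc g + room k false c e ≤ room k lonely (suc c) e
room-short k lonely {g} c e g≤k = begin
  suc g + room k false c e ≤⟨ +-monoˡ-≤ (room k false c e) (s≤s g≤k) ⟩
  suc k + room k false c e ≡⟨ regroup k c ⌊ suc (suc c) /2⌋ e ⟩
  room k true (suc c) e    ≤⟨ room-lonely≤room k lonely (suc c) e ⟩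
  room k lonely (suc c) e  ∎
  where
  open ≤-Reasoning
  regroup : ∀ k c h e → suc k + (c * suc k + k * h + e) ≡ suc c * suc k + k * h + e
  regroup = solve-∀

room-long : ∀ k c {g e e′} → g + e′ ≤ k + k + e →
            suc g + room k true c e′ ≤ room k false (suc c) e
room-long k c {g} {e} {e′} g+e′≤ = begin
  suc g + room k true c e′              ≡⟨ regroup k g c h e′ ⟩
  suc (g + e′) + (c * suc k + k * h)    ≤⟨ +-monoˡ-≤ (c * suc k + k * h) (s≤s g+e′≤) ⟩
  suc (k + k + e) + (c * suc k + k * h) ≡⟨ widen k c h e ⟩
  room k false (suc c) e                ∎
  where
  open ≤-Reasoning
  h : ℕ
  h = ⌊ suc c /2⌋
  regroup : ∀ k g c h e′ → suc g + (c * suc k + k * h + e′) ≡ suc (g + e′) + (c * suc k + k * h)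
  regroup = solve-∀
  widen : ∀ k c h e → suc (k + k + e) + (c * suc k + k * h) ≡ suc c * suc k + k * suc h + e
  widen = solve-∀

first-landmark-bound : ∀ k c {s e d} → s + e ≤ suc k → d ≤ room k true c e →
                       suc (s + d) ≤ bound k (suc c)
first-landmark-bound k c {s} {e} {d} s+e≤ d≤ = s≤s (begin
  s + d                                   ≤⟨ +-monoʳ-≤ s d≤ ⟩
  s + room k true c e                     ≡⟨ regroup k s c h e ⟩
  (s + e) + (c * suc k + k * h)           ≤⟨ +-monoˡ-≤ (c * suc k + k * h) s+e≤ ⟩
  suc k + (c * suc k + k * h)             ≡⟨ +-assoc (suc k) (c * suc k) (k * h) ⟨
  suc c * suc k + k * ⌊ suc c /2⌋         ∎)
  where
  open ≤-Reasoning
  h : ℕ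
  h = ⌊ suc c /2⌋
  regroup : ∀ k s c h e → s + (c * suc k + k * h + e) ≡ (s + e) + (c * suc k + k * h)
  regroup = solve-∀

first-landmark-at-0-bound : ∀ k c {d} → d ≤ room k false c 1 → suc d ≤ bound k (suc c)
first-landmark-at-0-bound k c {d} d≤ = s≤s (begin
  d                                ≤⟨ d≤ ⟩
  c * suc k + k * suc ⌊ c /2⌋ + 1   ≡⟨ regroup k c ⌊ c /2⌋ ⟩
  suc k + c * suc k + k * ⌊ c /2⌋   ≤⟨ +-monoʳ-≤ (suc k + c * suc k) (*-monoʳ-≤ k ⌊c/2⌋≤⌊1+c/2⌋) ⟩
  suc c * suc k + k * ⌊ suc c /2⌋   ∎)
  where
  open ≤-Reasoning
  regroup : ∀ k c h → c * suc k + k * suc h + 1 ≡ suc k + c * suc k + k * h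
  regroup = solve-∀
  ⌊c/2⌋≤⌊1+c/2⌋ : ⌊ c /2⌋ ≤ ⌊ suc c /2⌋
  ⌊c/2⌋≤⌊1+c/2⌋ = ⌊n/2⌋-mono (n≤1+n c)

module LowerBound (k n : ℕ) (f : ℕ → Bool) (adm : Path.Admissible k n f) where
  open Path k n f

  one : AtMostOneUncovered
  one = proj₁ adm

  noIso : NoIsolated
  noIso = proj₂ adm

  next-covered : ∀ {u} → Uncovered u → ¬ Uncovered (suc u)
  next-covered unc unc′ = <⇒≢ (n<1+n _) (one _ _ unc unc′)

  allowance-spent : ∀ {s u} → Uncovered u → u < s → Allowance 0 s
  allowance-spent {s} {u} unc u<s u′ unc′ s≤u′ =
    ⊥-elim (<⇒≱ u<s (subst (s ≤_) (sym (one u u′ unc unc′)) s≤u′))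

  lonely⇒short-gap : ∀ {s t} → IsLandmark s → suc s < n → Lonely true s → Gap s t →
                     ¬ suc (suc k) + s ≤ t
  lonely⇒short-gap {s} ls s+1<n (0<s , farL) gap s≪t =
    noIso s (ls , 0<s , s+1<n , farL , gap⇒farRight gap s≪t)

  -- The vertices s + j with k < j ≤ g - k are uncovered, and by (i) there is at most one.
  gap-length : ∀ {e s g} → Gap s (suc s + g) → suc s + g ≤ n + k → Allowance e s →
               g ≤ k + k ⊎ (g ≡ suc (k + k) × 0 < e × Uncovered (s + suc k))
  gap-length {e} {s} {g} gap t≤n+k allow = by-length (g ≤? k + k) (g ≤? suc (k + k))
    where
    uncovered-at : ∀ j → suc k ≤ j → suc k + j ≤ suc g → Uncovered (s + j)
    uncovered-at j k<j j≪t = uncovered-in-gap gap t≤n+k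
      (subst (_≤ s + j) (+-comm s (suc k)) (+-monoʳ-≤ s k<j))
      (subst₂ _≤_ (x∙yz≈y∙xz s (suc k) j) (+-suc s g) (+-monoʳ-≤ s j≪t))
    middle : ¬ g ≤ k + k → Uncovered (s + suc k)
    middle g≰2k = uncovered-at (suc k) ≤-refl (subst (_≤ suc g) (sym (+-suc (suc k) k)) (s≤s (≰⇒> g≰2k)))
    by-length : Dec (g ≤ k + k) → Dec (g ≤ suc (k + k)) →
                g ≤ k + k ⊎ (g ≡ suc (k + k) × 0 < e × Uncovered (s + suc k))
    by-length (yes g≤2k) _            = inj₁ g≤2k
    by-length (no g≰2k)  (yes g≤2k+1) =
      inj₂ (≤-antisym g≤2k+1 (≰⇒> g≰2k) , allow _ (middle g≰2k) (m≤m+n s (suc k)) , middle g≰2k)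
    by-length (no g≰2k)  (no g≰2k+1)  = ⊥-elim (next-covered (middle g≰2k) (subst Uncovered (+-suc s (suc k))
      (uncovered-at (suc (suc k)) (n≤1+n _) (subst (_≤ suc g) (sym 2k+3≡) (s≤s (≰⇒> g≰2k+1))))))
      where
      2k+3≡ : suc k + suc (suc k) ≡ suc (suc (suc (k + k)))
      2k+3≡ = trans (+-suc (suc k) (suc k)) (cong (suc ∘ suc) (+-suc k k))

  last-gap-length : ∀ {lonely e s d} → IsLandmark s → s + suc d ≡ n → Gap s n → Lonely lonely s →
                    Allowance e s → d ≤ room k lonely 0 e
  last-gap-length {true}  {d = zero}  _ _ _ _ _ = z≤n
  last-gap-length {true}  {s = s} {suc d} ls s+d≡n gap lonely _ =
    ⊥-elim (lonely⇒short-gap ls s+1<n lonely (gap-after-last gap) ≤-refl)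
    where
    s+1<n : suc s < n
    s+1<n = subst (suc s <_) (trans (sym (+-suc s (suc d))) s+d≡n) (s≤s (m<m+n s z<s))
  last-gap-length {false} {e} {s} {d} ls s+d≡n gap _ allow =
    ≤-trans d≤k+e (≤-reflexive (cong (_+ e) (sym (*-identityʳ k))))
    where
    end : suc s + (d + k) ≡ n + k
    end = trans (sym (+-assoc (suc s) d k)) (cong (_+ k) (trans (sym (+-suc s d)) s+d≡n))
    -- The end of the path acts as a landmark at n + k.
    d≤k+e : d ≤ k + e
    d≤k+e with gap-length {g = d + k} (gap-after-last gap) (≤-reflexive end) allow
    ... | inj₁ d+k≤2k         = ≤-trans (+-cancelʳ-≤ k d k d+k≤2k) (m≤m+n k e)
    ... | inj₂ (d+k≡ , 0<e , _) =
      ≤-trans (≤-reflexive (trans (+-cancelʳ-≡ k d (suc k) d+k≡) (+-comm 1 k))) (+-monoʳ-≤ k 0<e)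

  next-gap-length : ∀ {c lonely e s g d} → IsLandmark s → suc s + g < n → Gap s (suc s + g) →
    Lonely lonely s → Allowance e s →
    (∀ {lonely′ e′} → Lonely lonely′ (suc s + g) → Allowance e′ (suc s + g) → d ≤ room k lonely′ c e′) →
    suc g + d ≤ room k lonely (suc c) e
  next-gap-length {c} {lonely} {e} {s} {g} {d} ls t<n gap lon allow rest = by-length (g ≤? k)
    where
    s≤t : s ≤ suc s + g
    s≤t = ≤-trans (n≤1+n s) (m≤m+n (suc s) g)
    s≪t : k < g → suc (suc k) + s ≤ suc s + g
    s≪t k<g = s≤s (subst (_≤ s + g) (+-comm s (suc k)) (+-monoʳ-≤ s k<g))
    t-lonely : k < g → Lonely true (suc s + g)
    t-lonely k<g = z<s , gap⇒farLeft gap (s≪t k<g)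
    long : ∀ lonely → Lonely lonely s → k < g → suc g + d ≤ room k lonely (suc c) e
    long true  lon k<g = ⊥-elim (lonely⇒short-gap ls (≤-<-trans (m≤m+n (suc s) g) t<n) lon gap (s≪t k<g))
    long false _   k<g with gap-length gap (≤-trans (<⇒≤ t<n) (m≤m+n n k)) allow
    ... | inj₁ g≤2k =
      ≤-trans (+-monoʳ-≤ (suc g) (rest (t-lonely k<g) (allowance-later allow s≤t)))
              (room-long k c {g} {e} {e} (+-monoˡ-≤ e g≤2k))
    ... | inj₂ (g≡2k+1 , 0<e , middle) =
      ≤-trans (+-monoʳ-≤ (suc g) (rest (t-lonely k<g) (allowance-spent middle (s≤s (+-monoʳ-≤ s k<g)))))
              (room-long k c {g} {e} {0} (subst (_≤ k + k + e) g+0≡ (+-monoʳ-≤ (k + k) 0<e)))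
      where
      g+0≡ : k + k + 1 ≡ g + 0
      g+0≡ = sym (trans (+-identityʳ g) (trans g≡2k+1 (+-comm 1 (k + k))))
    by-length : Dec (g ≤ k) → suc g + d ≤ room k lonely (suc c) e
    by-length (yes g≤k) =
      ≤-trans (+-monoʳ-≤ (suc g) (rest tt (allowance-later allow s≤t))) (room-short k lonely c e g≤k)
    by-length (no g≰k)  = long lonely lon (≰⇒> g≰k)

  tail-length : ∀ c {lonely e s d} → IsLandmark s → s + suc d ≡ n → count f (suc s) d ≡ c →
                Lonely lonely s → Allowance e s → d ≤ room k lonely c e
  tail-length zero {s = s} {d} ls s+d≡n cnt lon allow = last-gap-length ls s+d≡n gap lon allow
    where
    gap : Gap s n
    gap = subst (Gap s) (trans (sym (+-suc s d)) s+d≡n) (window-gap s d (count≡0⇒none f (suc s) d cnt))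
  tail-length (suc c) {s = s} {d} ls s+d≡n cnt lon allow with count≡suc⇒first f (suc s) d cnt
  ... | g , d′ , refl , fg , none , cnt′ =
    next-gap-length ls t<n (window-gap s g none) lon allow λ lon′ allow′ →
      tail-length c (t<n , fg) t+d′≡n cnt′ lon′ allow′
    where
    regroup : ∀ s g d′ → suc s + g + suc d′ ≡ s + suc (suc (g + d′))
    regroup = solve-∀
    t+d′≡n : suc s + g + suc d′ ≡ n
    t+d′≡n = trans (regroup s g d′) s+d≡n
    t<n : suc s + g < n
    t<n = subst (suc s + g <_) t+d′≡n (m<m+n (suc s + g) z<s)

  first-gap-length : ∀ {s} → s < n → (∀ r → IsLandmark r → s ≤ r) → s ≤ k ⊎ (s ≡ suc k × Uncovered 0)
  first-gap-length {s} s<n after = by-position (s ≤? k) (s ≤? suc k)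
    where
    uncovered-before : ∀ {u} → suc k + u ≤ s → Uncovered u
    uncovered-before {u} u≪s =
      ≤-<-trans (m≤n+m u (suc k)) (≤-<-trans u≪s s<n) , λ r lr → inj₁ (≤-trans u≪s (after r lr))
    0≪s : ¬ s ≤ k → suc k + 0 ≤ s
    0≪s s≰k = subst (_≤ s) (sym (+-identityʳ (suc k))) (≰⇒> s≰k)
    by-position : Dec (s ≤ k) → Dec (s ≤ suc k) → s ≤ k ⊎ (s ≡ suc k × Uncovered 0)
    by-position (yes s≤k) _            = inj₁ s≤k
    by-position (no s≰k)  (yes s≤k+1) = inj₂ (≤-antisym s≤k+1 (≰⇒> s≰k) , uncovered-before (0≪s s≰k))
    by-position (no s≰k)  (no s≰k+1)  = ⊥-elim (next-covered (uncovered-before (0≪s s≰k))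
      (uncovered-before {1} (subst (_≤ s) (+-comm 1 (suc k)) (≰⇒> s≰k+1))))

  lower-bound : 0 < count f 0 n → n ≤ bound k (count f 0 n)
  lower-bound pos with count f 0 n in cnt
  ... | suc c with count≡suc⇒first f 0 n cnt
  ...   | s , d , n≡ , fs , none , cnt′ = subst (_≤ bound k (suc c)) (sym n≡) (by-position (s ≟ 0))
    where
    after-first : ∀ r → IsLandmark r → s ≤ r
    after-first r (_ , fr) with r <? s
    ... | yes r<s = ⊥-elim (none r r<s fr)
    ... | no r≮s  = ≮⇒≥ r≮s
    ls : IsLandmark s
    ls = subst (s <_) (sym n≡) (s≤s (m≤m+n s d)) , fs
    rest : ∀ {lonely e} → Lonely lonely s → Allowance e s → d ≤ room k lonely c e
    rest = tail-length c ls (trans (+-suc s d) (sym n≡)) cnt′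
    lonely : 0 < s → Lonely true s
    lonely 0<s = 0<s , λ t lt t<s → ⊥-elim (<⇒≱ t<s (after-first t lt))
    lonely-first : 0 < s → s ≤ k ⊎ (s ≡ suc k × Uncovered 0) → suc (s + d) ≤ bound k (suc c)
    lonely-first 0<s (inj₁ s≤k) =
      first-landmark-bound k c (subst (_≤ suc k) (+-comm 1 s) (s≤s s≤k)) (rest (lonely 0<s) allowance-1)
    lonely-first 0<s (inj₂ (s≡k+1 , unc0)) = first-landmark-bound k c (≤-reflexive (trans (+-identityʳ s) s≡k+1))
      (rest (lonely 0<s) (allowance-spent unc0 0<s))
    by-position : Dec (s ≡ 0) → suc (s + d) ≤ bound k (suc c)
    by-position (yes refl) = first-landmark-at-0-bound k c (rest tt allowance-1)
    by-position (no s≢0)   = lonely-first (n≢0⇒n>0 s≢0) (first-gap-length (proj₁ ls) after-first)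

Represents : ∀ {n} → Subset n → (ℕ → Bool) → Set
Represents {n} R f = ∀ (i : Fin n) → lookup R i ≡ f (toℕ i)

indicator : ∀ {n} → Subset n → ℕ → Bool
indicator []      _       = false
indicator (b ∷ R) zero    = b
indicator (b ∷ R) (suc i) = indicator R i

indicator-represents : ∀ {n} (R : Subset n) → Represents R (indicator R)
indicator-represents (b ∷ R) fzero    = refl
indicator-represents (b ∷ R) (fsuc i) = indicator-represents R i

tabulate-represents : ∀ {n} (f : ℕ → Bool) → Represents (tabulate {n = n} (f ∘ toℕ)) f
tabulate-represents f = lookup∘tabulate (f ∘ toℕ)

∣∷∣ : ∀ {n} b (R : Subset n) → ∣ b ∷ R ∣ ≡ (if b then suc ∣ R ∣ else ∣ R ∣)
∣∷∣ true  R = refl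
∣∷∣ false R = refl

∣∣≡count : ∀ {n} (R : Subset n) {f} → Represents R f → ∣ R ∣ ≡ count f 0 n
∣∣≡count []              rep = refl
∣∣≡count {suc n} (b ∷ R) rep = trans (∣∷∣ b R)
  (cong₂ (λ x y → if x then suc y else y) (rep fzero)
    (trans (∣∣≡count R (rep ∘ fsuc)) (count-cong 0 1 n λ _ _ → refl)))

module _ {k n : ℕ} {R : Subset n} {f : ℕ → Bool} (rep : Represents R f) where
  open Path k n f

  member⇒landmark : ∀ r → r ∈ R → IsLandmark (toℕ r)
  member⇒landmark r r∈R = toℕ<n r , Equivalence.from T-≡ (trans (sym (rep r)) ([]=⇒lookup r∈R))

  landmark⇒member : ∀ {r} (lr : IsLandmark r) → fromℕ< (proj₁ lr) ∈ R
  landmark⇒member {r} (r<n , fr) = lookup⇒[]= (fromℕ< r<n) R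
    (trans (rep (fromℕ< r<n)) (trans (cong f (toℕ-fromℕ< r<n)) (Equivalence.to T-≡ fr)))

  truncResolving⇒resolving : IsTruncResolving k R → Resolving
  truncResolving⇒resolving (_ , res) u v u<n v<n sig = begin
    u                     ≡⟨ toℕ-fromℕ< u<n ⟨
    toℕ (fromℕ< u<n)      ≡⟨ cong toℕ (res (fromℕ< u<n) (fromℕ< v<n) sig′) ⟩
    toℕ (fromℕ< v<n)      ≡⟨ toℕ-fromℕ< v<n ⟩
    v                     ∎
    where
    open ≡-Reasoning
    sig′ : ∀ r → r ∈ R → truncDist k (fromℕ< u<n) r ≡ truncDist k (fromℕ< v<n) r
    sig′ r r∈R = subst₂ (λ x y → tdist x (toℕ r) ≡ tdist y (toℕ r))
                   (sym (toℕ-fromℕ< u<n)) (sym (toℕ-fromℕ< v<n)) (sig (toℕ r) (member⇒landmark r r∈R))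

  resolving⇒truncResolving : ∀ {r} → Resolving → IsLandmark r → IsTruncResolving k R
  resolving⇒truncResolving res lr = (fromℕ< (proj₁ lr) , landmark⇒member lr) , λ u v sig →
    toℕ-injective (res (toℕ u) (toℕ v) (toℕ<n u) (toℕ<n v) λ r lr′ →
      subst (λ t → tdist (toℕ u) t ≡ tdist (toℕ v) t) (toℕ-fromℕ< (proj₁ lr′))
        (sig _ (landmark⇒member lr′)))

  truncResolving⇒0<count : IsTruncResolving k R → 0 < count f 0 n
  truncResolving⇒0<count ((r , r∈R) , _) =
    n≢0⇒n>0 λ c≡0 → count≡0⇒none f 0 n c≡0 (toℕ r) (toℕ<n r) (proj₂ (member⇒landmark r r∈R))

isTruncMetricDimPath : ∀ {k n b} (f : ℕ → Bool) → Path.Admissible k n f → count f 0 n ≡ suc b →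
            (∀ c → 0 < c → n ≤ bound k c → b < c) → IsTruncMetricDimPath k n (suc b)
isTruncMetricDimPath {k} {n} {b} f adm cnt least = (R , resolves , trans (∣∣≡count R rep) cnt) , minimal
  where
  R : Subset n
  R = tabulate (f ∘ toℕ)
  rep : Represents R f
  rep = tabulate-represents f
  resolves : IsTruncResolving k R
  resolves with count≡suc⇒first f 0 n cnt
  ... | s , d , n≡ , fs , _ = resolving⇒truncResolving {k = k} rep (Path.admissible⇒resolving k n f adm)
                                (subst (s <_) (sym n≡) (s≤s (m≤m+n s d)) , fs)
  minimal : (R′ : Subset n) → IsTruncResolving k R′ → suc b ≤ ∣ R′ ∣
  minimal R′ tres = subst (b <_) (sym (∣∣≡count R′ rep′)) (least _ pos (LowerBound.lower-bound k n f′ adm′ pos))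
    where
    f′ : ℕ → Bool
    f′ = indicator R′
    rep′ : Represents R′ f′
    rep′ = indicator-represents R′
    open Path k n f′
    res : Resolving
    res = truncResolving⇒resolving rep′ tres
    adm′ : Admissible
    adm′ = resolving⇒atMostOneUncovered res , resolving⇒noIsolated res
    pos : 0 < count f′ 0 n
    pos = truncResolving⇒0<count rep′ tres

module Construction (k : ℕ) where

  q : ℕ
  q = period k

  pair : ℕ → ℕ → Bool
  pair p i = (i ≡ᵇ k) ∨ (i ≡ᵇ p)

  pair⇒≡ : ∀ {p i} → T (pair p i) → i ≡ k ⊎ i ≡ p
  pair⇒≡ {i = i} fi with Equivalence.to T-∨ fi
  ... | inj₁ i≡ᵇk = inj₁ (≡ᵇ⇒≡ i k i≡ᵇk)
  ... | inj₂ i≡ᵇp = inj₂ (≡ᵇ⇒≡ i _ i≡ᵇp)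

  ≡⇒pair : ∀ p {i} → i ≡ k ⊎ i ≡ p → T (pair p i)
  ≡⇒pair p {i} (inj₁ i≡k) = Equivalence.from (T-∨ {i ≡ᵇ k}) (inj₁ (≡⇒≡ᵇ i k i≡k))
  ≡⇒pair p {i} (inj₂ i≡p) = Equivalence.from (T-∨ {i ≡ᵇ k}) (inj₂ (≡⇒≡ᵇ i p i≡p))

  pair-admissible : ∀ {p N} → k < p → p ≤ suc (k + k) → p < N → N ≤ suc (p + k) →
                    Path.Admissible k N (pair p)
  pair-admissible {p} {N} k<p p≤2k+1 p<N N≤ =
    (λ u _ unc _ → ⊥-elim (pair-covers lk lp p≤2k+1 (≤-pred (≤-trans (proj₁ unc) N≤)) unc)) , noIso
    where
    open Path k N (pair p)
    lk : IsLandmark k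
    lk = <-trans k<p p<N , ≡⇒pair p (inj₁ refl)
    lp : IsLandmark p
    lp = p<N , ≡⇒pair p (inj₂ refl)
    noIso : NoIsolated
    noIso r iso with pair⇒≡ {i = r} (proj₂ (proj₁ iso))
    ... | inj₁ refl = proj₁ (pair-not-isolated lk lp k<p p≤2k+1) iso
    ... | inj₂ refl = proj₂ (pair-not-isolated lk lp k<p p≤2k+1) iso

  pair-count : ∀ {p N} → k < p → p < N → count (pair p) 0 N ≡ 2
  pair-count {p} {N} k<p p<N =
    trans (count-∨ (_≡ᵇ k) (_≡ᵇ p) 0 N disjoint)
          (cong₂ _+_ (count-single k 0 N z≤n (<-trans k<p p<N)) (count-single p 0 N z≤n p<N))
    where
    disjoint : ∀ i → T (i ≡ᵇ k) → T (i ≡ᵇ p) → ⊥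
    disjoint i i≡ᵇk i≡ᵇp = <⇒≢ k<p (trans (sym (≡ᵇ⇒≡ i k i≡ᵇk)) (≡ᵇ⇒≡ i p i≡ᵇp))

  single-admissible : ∀ {N} → 0 < N → N ≤ suc (suc k) → Path.Admissible k N (_≡ᵇ 0)
  single-admissible {N} 0<N N≤ = (λ u v unc-u unc-v → trans (pinned unc-u) (sym (pinned unc-v))) , noIso
    where
    open Path k N (_≡ᵇ 0)
    pinned : ∀ {u} → Uncovered u → u ≡ suc k
    pinned {u} (u<N , far) with far 0 (0<N , _)
    ... | inj₁ ()
    ... | inj₂ k<u = ≤-antisym (≤-pred (≤-trans u<N N≤)) (subst (_≤ u) (+-identityʳ (suc k)) k<u)
    noIso : NoIsolated
    noIso r ((_ , r≡ᵇ0) , 0<r , _) = <⇒≢ 0<r (sym (≡ᵇ⇒≡ r 0 r≡ᵇ0))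

  empty-admissible : ∀ {N} → N ≤ 1 → Path.Admissible k N (λ _ → false)
  empty-admissible {N} N≤1 = (λ u v (u<N , _) (v<N , _) → trans (at-0 u<N) (sym (at-0 v<N))) , noIso
    where
    open Path k N (λ _ → false)
    at-0 : ∀ {u} → u < N → u ≡ 0
    at-0 u<N = n<1⇒n≡0 (≤-trans u<N N≤1)
    noIso : NoIsolated
    noIso _ ((_ , ()) , _)

  prepend : (ℕ → Bool) → ℕ → Bool
  prepend f i with i <? q
  ... | yes _ = pair (suc (k + k)) i
  ... | no  _ = f (i ∸ q)

  prepend-block : ∀ f {i} → i < q → prepend f i ≡ pair (suc (k + k)) i
  prepend-block f {i} i<q with i <? q
  ... | yes _   = refl
  ... | no i≮q = ⊥-elim (i≮q i<q)

  prepend-shift : ∀ f j → prepend f (q + j) ≡ f j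
  prepend-shift f j with q + j <? q
  ... | yes q+j<q = ⊥-elim (m+n≮m q j q+j<q)
  ... | no _      = cong f (m+n∸m≡n q j)

  k<2k+1 : k < suc (k + k)
  k<2k+1 = s≤s (m≤m+n k k)

  2k+1<q : suc (k + k) < q
  2k+1<q = s≤s (s≤s (subst (k + k ≤_) (3k≡ k) (m≤m+n (k + k) k)))
    where
    3k≡ : ∀ k → k + k + k ≡ 3 * k
    3k≡ = solve-∀

  module Prepended (N : ℕ) (f : ℕ → Bool) where
    module Old = Path k N f
    open Path k (q + N) (prepend f)

    shift : ∀ {t} → Old.IsLandmark t → IsLandmark (q + t)
    shift (t<N , ft) = +-monoʳ-< q t<N , subst T (sym (prepend-shift f _)) ft

    unshift : ∀ {t} → IsLandmark (q + t) → Old.IsLandmark t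
    unshift (t<N , ft) = +-cancelˡ-< q _ _ t<N , subst T (prepend-shift f _) ft

    block-landmark : ∀ {i} → i < q → T (pair (suc (k + k)) i) → IsLandmark i
    block-landmark i<q fi = ≤-trans i<q (m≤m+n q N) , subst T (sym (prepend-block f i<q)) fi

    lk : IsLandmark k
    lk = block-landmark (<-trans k<2k+1 2k+1<q) (≡⇒pair (suc (k + k)) (inj₁ refl))

    l2k+1 : IsLandmark (suc (k + k))
    l2k+1 = block-landmark 2k+1<q (≡⇒pair (suc (k + k)) (inj₂ refl))

    block-or-shifted : ∀ r → r < q ⊎ (∃[ j ] r ≡ q + j)
    block-or-shifted r with r <? q
    ... | yes r<q = inj₁ r<q
    ... | no r≮q  = inj₂ (r ∸ q , sym (m+[n∸m]≡n (≮⇒≥ r≮q)))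

    block-covered : ∀ {u} → u < q → ¬ Uncovered u
    block-covered {u} u<q = pair-covers lk l2k+1 ≤-refl (≤-pred (subst (u <_) (q≡ k) u<q))
      where
      q≡ : ∀ k → suc (suc (3 * k)) ≡ suc (suc (k + k) + k)
      q≡ = solve-∀

    unshift-uncovered : ∀ {j} → Uncovered (q + j) → Old.Uncovered j
    unshift-uncovered (q+j<q+N , far) =
      +-cancelˡ-< q _ _ q+j<q+N , λ t lt → apart-cancelˡ q (far (q + t) (shift lt))

    atMostOneUncovered : Old.AtMostOneUncovered → AtMostOneUncovered
    atMostOneUncovered one u v unc-u unc-v with block-or-shifted u | block-or-shifted v
    ... | inj₁ u<q         | _                 = ⊥-elim (block-covered u<q unc-u)
    ... | inj₂ _           | inj₁ v<q          = ⊥-elim (block-covered v<q unc-v)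
    ... | inj₂ (j , refl)  | inj₂ (j′ , refl)  =
      cong (q +_) (one j j′ (unshift-uncovered unc-u) (unshift-uncovered unc-v))

    noIsolated : Old.NoIsolated → NoIsolated
    noIsolated noIso r iso with block-or-shifted r
    ... | inj₁ r<q with pair⇒≡ {i = r} (subst T (prepend-block f r<q) (proj₂ (proj₁ iso)))
    ...   | inj₁ refl = proj₁ (pair-not-isolated lk l2k+1 k<2k+1 ≤-refl) iso
    ...   | inj₂ refl = proj₂ (pair-not-isolated lk l2k+1 k<2k+1 ≤-refl) iso
    noIsolated noIso r (_ , _ , _ , farL , _) | inj₂ (zero , refl) =
      <-irrefl refl (subst₂ _≤_ (sym (q+1≡ k)) (+-identityʳ q)
        (farL (suc (k + k)) l2k+1 (≤-trans 2k+1<q (m≤m+n q 0))))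
      where
      q+1≡ : ∀ k → suc (suc (suc (3 * k))) ≡ suc (suc k) + suc (k + k)
      q+1≡ = solve-∀
    noIsolated noIso r (lr , _ , r+1<q+N , farL , farR) | inj₂ (suc j , refl) =
      noIso (suc j) (unshift lr , z<s , j+2<N , farL′ , farR′)
      where
      j+2<N : suc (suc j) < N
      j+2<N = +-cancelˡ-< q _ _ (subst (_< q + N) (sym (+-suc q (suc j))) r+1<q+N)
      farL′ : Old.FarLeft (suc j)
      farL′ t lt t<j = d+[m+x]≤m+y⇒d+x≤y (suc (suc k)) q (farL (q + t) (shift lt) (+-monoʳ-< q t<j))
      farR′ : Old.FarRight (suc j)
      farR′ t lt j<t = d+[m+x]≤m+y⇒d+x≤y (suc (suc k)) q (farR (q + t) (shift lt) (+-monoʳ-< q j<t))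

  prepend-admissible : ∀ {N f} → Path.Admissible k N f → Path.Admissible k (q + N) (prepend f)
  prepend-admissible {N} {f} (one , noIso) =
    Prepended.atMostOneUncovered N f one , Prepended.noIsolated N f noIso

  prepend-count : ∀ f N → count (prepend f) 0 (q + N) ≡ 2 + count f 0 N
  prepend-count f N = trans (count-++ (prepend f) 0 q N) (cong₂ _+_ block shifted)
    where
    block : count (prepend f) 0 q ≡ 2
    block = trans (count-cong 0 0 q λ i i<q → prepend-block f i<q) (pair-count k<2k+1 2k+1<q)
    shifted : count (prepend f) q N ≡ count f 0 N
    shifted = count-cong q 0 N λ i _ → prepend-shift f i

  blocks : ℕ → (ℕ → Bool) → ℕ → Bool
  blocks zero    f = f
  blocks (suc m) f = prepend (blocks m f)

  blocks-admissible : ∀ m {N f} → Path.Admissible k N f → Path.Admissible k (m * q + N) (blocks m f)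
  blocks-admissible zero    adm = adm
  blocks-admissible (suc m) {N} {f} adm =
    subst (λ L → Path.Admissible k L (blocks (suc m) f)) (sym (+-assoc q (m * q) N))
      (prepend-admissible (blocks-admissible m adm))

  blocks-count : ∀ m f N → count (blocks m f) 0 (m * q + N) ≡ 2 * m + count f 0 N
  blocks-count zero    f N = refl
  blocks-count (suc m) f N = begin
    count (blocks (suc m) f) 0 (q + m * q + N)    ≡⟨ cong (count (blocks (suc m) f) 0) (+-assoc q (m * q) N) ⟩
    count (prepend (blocks m f)) 0 (q + (m * q + N)) ≡⟨ prepend-count (blocks m f) (m * q + N) ⟩
    2 + count (blocks m f) 0 (m * q + N)          ≡⟨ cong (2 +_) (blocks-count m f N) ⟩
    2 + (2 * m + count f 0 N)                     ≡⟨ regroup m (count f 0 N) ⟩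
    2 * suc m + count f 0 N                       ∎
    where
    open ≡-Reasoning
    regroup : ∀ m c → 2 + (2 * m + c) ≡ 2 * suc m + c
    regroup = solve-∀

  pair-position : ∀ {N} → k + 3 ≤ N → N ≤ 3 * k + 1 →
                  ∃[ p ] k < p × p ≤ suc (k + k) × p < N × N ≤ suc (p + k)
  pair-position {zero} k+3≤0 _ with m+n≤o⇒n≤o k k+3≤0
  ... | ()
  pair-position {suc N} k+3≤ N≤ with N ≤? suc (k + k)
  ... | yes N≤2k+1 = N , k<N , N≤2k+1 , ≤-refl , s≤s (m≤m+n N k)
    where
    k<N : k < N
    k<N = <⇒≤ (≤-pred (subst (_≤ suc N) (+-comm k 3) k+3≤))
  ... | no N≰2k+1 =
    suc (k + k) , k<2k+1 , ≤-refl , s≤s (<⇒≤ (≰⇒> N≰2k+1)) ,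
    ≤-trans N≤ (subst (3 * k + 1 ≤_) (3k+2≡ k) (n≤1+n _))
    where
    3k+2≡ : ∀ k → suc (3 * k + 1) ≡ suc (suc (k + k) + k)
    3k+2≡ = solve-∀

module Remainder (k n : ℕ) where
  open Construction k

  m r : ℕ
  m = n / q
  r = n % q

  blocks-dimension : ∀ {f b} → Path.Admissible k r f → 2 * m + count f 0 r ≡ suc b →
                     bound k b < m * q + r → IsTruncMetricDimPath k n (suc b)
  blocks-dimension {f} adm cnt bound<n = subst (λ N → IsTruncMetricDimPath k N _) n≡
    (isTruncMetricDimPath (blocks m f) (blocks-admissible m adm) (trans (blocks-count m f r) cnt)
      λ _ _ → bound<⇒< bound<n)
    where
    n≡ : m * q + r ≡ n
    n≡ = trans (+-comm (m * q) r) (sym (m≡m%n+[m/n]*n n q))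

  dimension-2m : 0 < n → 0 < k → n ≢ 1 → r ≤ 1 → IsTruncMetricDimPath k n (2 * m)
  dimension-2m 0<n 0<k n≢1 r≤1 = by-quotient m refl
    where
    by-quotient : ∀ x → m ≡ x → IsTruncMetricDimPath k n (2 * x)
    by-quotient zero     m≡0 = ⊥-elim (n≢1 (≤-antisym (subst (_≤ 1) (sym n≡r) r≤1) 0<n))
      where
      n≡r : n ≡ r
      n≡r = trans (m≡m%n+[m/n]*n n q) (trans (cong (λ x → r + x * q) m≡0) (+-identityʳ r))
    by-quotient (suc m′) m≡ = subst (IsTruncMetricDimPath k n) (sym (double-suc m′))
      (blocks-dimension (empty-admissible r≤1) cnt (subst (bound k (suc (2 * m′)) <_) regroup
        (bound-odd< k m′ k+2<q+r)))
      where
      double-suc : ∀ m → 2 * suc m ≡ suc (suc (2 * m))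
      double-suc = solve-∀
      cnt : 2 * m + count (λ _ → false) 0 r ≡ suc (suc (2 * m′))
      cnt = trans (cong₂ _+_ (cong (2 *_) m≡) (count-none _ 0 r λ _ _ ()))
              (trans (+-identityʳ _) (double-suc m′))
      k<3k : k < 3 * k
      k<3k = subst (_≤ 3 * k) (+-comm k 1) (+-monoʳ-≤ k (≤-trans 0<k (m≤m+n k (k + 0))))
      k+2<q+r : suc (suc k) < q + r
      k+2<q+r = ≤-trans (s≤s (s≤s k<3k)) (m≤m+n q r)
      regroup : m′ * q + (q + r) ≡ m * q + r
      regroup = trans (sym (+-assoc (m′ * q) q r))
                  (trans (cong (_+ r) (+-comm (m′ * q) q)) (cong (λ x → x * q + r) (sym m≡)))

  dimension-2m+1 : 2 ≤ r → r ≤ k + 2 → IsTruncMetricDimPath k n (2 * m + 1)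
  dimension-2m+1 2≤r r≤k+2 = subst (IsTruncMetricDimPath k n) (+-comm 1 (2 * m))
    (blocks-dimension (single-admissible 0<r (subst (r ≤_) (+-comm k 2) r≤k+2)) cnt (bound-even< k m 2≤r))
    where
    0<r : 0 < r
    0<r = ≤-trans (s≤s z≤n) 2≤r
    cnt : 2 * m + count (_≡ᵇ 0) 0 r ≡ suc (2 * m)
    cnt = trans (cong (2 * m +_) (count-single 0 0 r z≤n 0<r)) (+-comm (2 * m) 1)

  dimension-2m+2 : k + 3 ≤ r → r ≤ 3 * k + 1 → IsTruncMetricDimPath k n (2 * m + 2)
  dimension-2m+2 k+3≤r r≤3k+1 with pair-position k+3≤r r≤3k+1
  ... | p , k<p , p≤2k+1 , p<r , r≤p+k+1 = subst (IsTruncMetricDimPath k n) (+-comm 2 (2 * m))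
    (blocks-dimension (pair-admissible k<p p≤2k+1 p<r r≤p+k+1) cnt
      (bound-odd< k m (subst (_≤ r) (+-comm k 3) k+3≤r)))
    where
    cnt : 2 * m + count (pair p) 0 r ≡ suc (suc (2 * m))
    cnt = trans (cong (2 * m +_) (pair-count k<p p<r)) (+-comm (2 * m) 2)

theorem1 : (n k : ℕ) → 0 < n → 0 < k →
    (n ≡ 1 → IsTruncMetricDimPath k n 1) ×
    (n ≢ 1 → n % (suc (suc (3 * k))) ≤ 1 →
      IsTruncMetricDimPath k n (2 * (n / (suc (suc (3 * k)))))) ×
    (2 ≤ n % (suc (suc (3 * k))) → n % (suc (suc (3 * k))) ≤ k + 2 →
      IsTruncMetricDimPath k n (2 * (n / (suc (suc (3 * k)))) + 1)) ×
    (k + 3 ≤ n % (suc (suc (3 * k))) → n % (suc (suc (3 * k))) ≤ 3 * k + 1 →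
      IsTruncMetricDimPath k n (2 * (n / (suc (suc (3 * k)))) + 2))
theorem1 n k 0<n 0<k = single , dimension-2m 0<n 0<k , dimension-2m+1 , dimension-2m+2
  where
  open Remainder k n
  single : n ≡ 1 → IsTruncMetricDimPath k n 1
  single refl =
    isTruncMetricDimPath (_≡ᵇ 0) (Construction.single-admissible k z<s (s≤s z≤n)) refl λ _ 0<c _ → 0<c
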